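{- Let $m,k,d$ be positive integers with $d\ge k$, let $a_1,\dots,a_k$ be positive integers with $a_1+\dots+a_k\le m$, and let $S$ be a uniformly random subset of $[m]$ of size $d$. For a family $\mathcal F=\{A_1,\dots,A_k\}$ of subsets of $[m]$ with $|A_i|=a_i$, let $p(\mathcal F)$ be the probability that $\{S\cap A_1,\dots,S\cap A_k\}$ has a system of distinct representatives. Then, among all such families, $p(\mathcal F)$ is maximised by families whose members $A_1,\dots,A_k$ are mutually disjoint.
   Context: A system of distinct representatives of sets $B_1,\dots,B_k$ is a choice of pairwise distinct elements $x_1,\dots,x_k$ with $x_i\in B_i$ for all $i$. -}

module Defs where

open import Data.Nat as ℕ using (ℕ; zero; suc)
open import Data.Nat.Properties as ℕP using ()
open import Data.Fin using (Fin)
open import Data.Fin.Properties using (any?; all?; _≟_)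
open import Data.Fin.Subset using (Subset; _∈_; _∩_; ∣_∣)
open import Data.Fin.Subset.Properties using (_∈?_)
open import Data.Vec using (Vec; []; _∷_; lookup)
open import Data.List using (List; []; _∷_; map; _++_; filter; length)
open import Data.Bool using (true; false)
open import Data.Product using (Σ; ∃; _×_; _,_)
open import Data.Empty using (⊥)
open import Relation.Nullary using (Dec; yes; no; ¬_)
open import Relation.Nullary.Decidable using (_×-dec_; _→-dec_; map′)
open import Relation.Binary.PropositionalEquality using (_≡_; _≢_)

allSubsets : ∀ n → List (Subset n)
allSubsets zero = [] ∷ []
allSubsets (suc n) = map (false ∷_) (allSubsets n) ++ map (true ∷_) (allSubsets n)

IsSDR : ∀ {m k} → (Fin k → Subset m) → Vec (Fin m) k → Set
IsSDR B v = (∀ i → lookup v i ∈ B i) × (∀ i j → lookup v i ≡ lookup v j → i ≡ j)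

HasSDR : ∀ {m k} → (Fin k → Subset m) → Set
HasSDR B = ∃ λ v → IsSDR B v

PairwiseDisjoint : ∀ {m k} → (Fin k → Subset m) → Set
PairwiseDisjoint A = ∀ i j → i ≢ j → ∀ x → x ∈ A i → x ∈ A j → ⊥

∃Vec? : ∀ {m} k (P : Vec (Fin m) k → Set) → (∀ v → Dec (P v)) → Dec (∃ P)
∃Vec? zero P P? with P? []
... | yes p = yes ([] , p)
... | no ¬p = no λ { ([] , p) → ¬p p }
∃Vec? {m} (suc k) P P? =
  map′ (λ { (x , v , p) → (x ∷ v) , p }) (λ { ((x ∷ v) , p) → x , v , p })
       (any? λ x → ∃Vec? k (λ v → P (x ∷ v)) (λ v → P? (x ∷ v)))

IsSDR? : ∀ {m k} (B : Fin k → Subset m) v → Dec (IsSDR B v)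
IsSDR? B v = all? (λ i → lookup v i ∈? B i)
       ×-dec all? (λ i → all? λ j → (lookup v i ≟ lookup v j) →-dec (i ≟ j))

HasSDR? : ∀ {m k} (B : Fin k → Subset m) → Dec (HasSDR B)
HasSDR? {m} {k} B = ∃Vec? k (IsSDR B) (IsSDR? B)

-- Number of d-subsets S of [m] such that {S ∩ A_1, …, S ∩ A_k} has an SDR.
-- p(F) = sdrCount m d F / (m choose d), so comparing p is comparing sdrCount.
sdrCount : ∀ {k} m (d : ℕ) → (Fin k → Subset m) → ℕ
sdrCount m d A =
  length (filter (λ S → (∣ S ∣ ℕ.≟ d) ×-dec HasSDR? (λ i → S ∩ A i)) (allSubsets m))

-- Count the d-sets S of [m] whose traces S ∩ F i have a system of distinct representatives.
-- Two operations never decrease this count: exchanging two points x and y in every member of the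
-- family (a relabelling of [m]), and moving a point x of one member F j to a point y lying in no
-- member.  Both are checked block by block, grouping the sets S according to their trace outside
-- {x, y}.  While two members overlap, the size bound ∑ aᵢ ≤ m leaves an uncovered point, and
-- moving an overlapping point there leaves fewer points uncovered; so F can be made pairwise
-- disjoint.  A disjoint F is then turned into G by exchanges of x ∈ F j ∖ G j with y ∈ G j ∖ F j,
-- each of which increases the number of incidences F shares with G, until F i ⊆ G i for all i.

module Submission where

open import Defs
open import Data.Nat using (ℕ; _≤_)
open import Data.Fin using (Fin)
open import Data.Fin.Subset using (Subset; ∣_∣)
open import Data.List using (map; allFin)
open import Data.Nat.ListAction using (sum)
open import Relation.Binary.PropositionalEquality using (_≡_)

open import Data.Bool using (Bool; true; false; if_then_else_)
open import Data.Fin using (zero; suc; punchIn; punchOut)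
open import Data.Fin.Permutation as Perm using (Permutation′; _⟨$⟩ʳ_; _⟨$⟩ˡ_; inverseˡ; inverseʳ; transpose)
open import Data.Fin.Properties using (_≟_; any?; all?; punchIn-punchOut)
open import Data.Fin.Subset using (_∈_; _∉_; _∩_; _⊆_)
open import Data.Fin.Subset.Properties using (_∈?_; x∈p∩q⁺; x∈p∩q⁻; p⊂q⇒∣p∣<∣q∣)
open import Data.List as List using (List; _++_; filter; length)
open import Data.List.Properties using (map-++; map-∘)
open import Data.Nat as ℕ using (zero; suc; _+_; _∸_; _<_; z≤n; s≤s)
open import Data.Nat.Induction using (<-wellFounded)
open import Data.Nat.ListAction.Properties using (sum-++)
open import Data.Nat.Properties
  using (≤-refl; ≤-reflexive; ≤-trans; ≤-antisym; <-irrefl; <⇒≱; +-assoc; +-identityʳ;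
         +-mono-≤; +-mono-<-≤; +-monoʳ-≤; m≤m+n; m≤n+m; ∸-monoʳ-<; module ≤-Reasoning;
         +-0-commutativeMonoid; +-commutativeSemigroup)
open import Algebra.Properties.CommutativeMonoid.Sum +-0-commutativeMonoid
  using (sum-syntax; sum-cong-≗; sum-remove; ∑-comm; ∑-permute)
open import Algebra.Properties.CommutativeSemigroup +-commutativeSemigroup using (interchange)
open import Data.Product as Product using (∃; _×_; _,_; proj₁; proj₂)
open import Data.Sum using (_⊎_; inj₁; inj₂; [_,_]′)
open import Data.Vec as Vec using ([]; _∷_; lookup; tabulate)
open import Data.Vec.Functional using (updateAt)
open import Data.Vec.Functional.Properties using (updateAt-updates; updateAt-minimal)
open import Data.Vec.Properties
  using ([]=⇒lookup; lookup⇒[]=; lookup-map; lookup∘tabulate; tabulate∘lookup; tabulate-cong)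
open import Function using (id; _∘_; flip)
open import Induction.WellFounded using (Acc; acc)
open import Level using (Level)
open import Relation.Binary.PropositionalEquality
  using (_≢_; refl; sym; trans; cong; cong₂; subst; subst₂; module ≡-Reasoning)
open import Relation.Nullary using (Dec; yes; no; does; ¬_; contradiction)
open import Relation.Nullary.Decidable using (dec-true; dec-false; decidable-stable; _×-dec_; ¬?)
open import Relation.Unary using (Decidable)

private
  variable
    ℓ ℓ′ : Level
    A : Set ℓ
    P P₁ P₂ Q Q₁ Q₂ : Set ℓ
    m n : ℕ


χ : Dec P → ℕ
χ P? = if does P? then 1 else 0

χ-mono : (P? : Dec P) (Q? : Dec Q) → (P → Q) → χ P? ≤ χ Q?
χ-mono (no _)  _       _   = z≤n
χ-mono (yes _) (yes _) _   = ≤-refl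
χ-mono (yes p) (no ¬q) P→Q = contradiction (P→Q p) ¬q

χ-cong : (P? : Dec P) (Q? : Dec Q) → (P → Q) → (Q → P) → χ P? ≡ χ Q?
χ-cong P? Q? P→Q Q→P = ≤-antisym (χ-mono P? Q? P→Q) (χ-mono Q? P? Q→P)

χ-mono-< : (P? : Dec P) (Q? : Dec Q) → ¬ P → Q → χ P? < χ Q?
χ-mono-< (no _)  (yes _) _  _ = ≤-refl
χ-mono-< (yes p) _       ¬p _ = contradiction p ¬p
χ-mono-< (no _)  (no ¬q) _  q = contradiction q ¬q

χ-pos : (P? : Dec P) → P → 1 ≤ χ P?
χ-pos P? p = χ-mono (yes p) P? id

χ-+-mono : (P₁? : Dec P₁) (P₂? : Dec P₂) (Q₁? : Dec Q₁) (Q₂? : Dec Q₂) →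
           (P₁ → Q₁ × Q₂) → (P₂ → Q₁ ⊎ Q₂) → χ P₁? + χ P₂? ≤ χ Q₁? + χ Q₂?
χ-+-mono (yes _)  (yes _) (yes _)  (yes _)  _ _ = ≤-refl
χ-+-mono (yes _)  (no _)  (yes _)  (yes _)  _ _ = s≤s z≤n
χ-+-mono (yes p₁) _       (no ¬q₁) _        h _ = contradiction (proj₁ (h p₁)) ¬q₁
χ-+-mono (yes p₁) _       (yes _)  (no ¬q₂) h _ = contradiction (proj₂ (h p₁)) ¬q₂
χ-+-mono (no _)   (no _)  _        _        _ _ = z≤n
χ-+-mono (no _)   (yes p₂) Q₁? Q₂? _ h with h p₂
... | inj₁ q₁ = ≤-trans (χ-pos Q₁? q₁) (m≤m+n _ _)
... | inj₂ q₂ = ≤-trans (χ-pos Q₂? q₂) (m≤n+m _ _)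

∑-mono-≤ : {f g : Fin n → ℕ} → (∀ i → f i ≤ g i) → ∑[ i < n ] f i ≤ ∑[ i < n ] g i
∑-mono-≤ {zero}  f≤g = z≤n
∑-mono-≤ {suc n} f≤g = +-mono-≤ (f≤g zero) (∑-mono-≤ (f≤g ∘ suc))

∑-mono-< : {f g : Fin n → ℕ} (i : Fin n) → (∀ j → f j ≤ g j) → f i < g i →
           ∑[ j < n ] f j < ∑[ j < n ] g j
∑-mono-< {suc n} {f} {g} i f≤g fi<gi =
  subst₂ _<_ (sym (sum-remove {i = i} f)) (sym (sum-remove {i = i} g))
    (+-mono-<-≤ fi<gi (∑-mono-≤ (λ j → f≤g (punchIn i j))))

≤-∑ : (f : Fin n → ℕ) (i : Fin n) → f i ≤ ∑[ j < n ] f j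
≤-∑ {suc n} f i = subst (f i ≤_) (sym (sum-remove {i = i} f)) (m≤m+n (f i) _)

+-≤-∑ : (f : Fin n → ℕ) {i j : Fin n} → i ≢ j → f i + f j ≤ ∑[ l < n ] f l
+-≤-∑ {suc n} f {i} {j} i≢j = begin
  f i + f j                                         ≡⟨ cong (λ l → f i + f l) (punchIn-punchOut i≢j) ⟨
  f i + f (punchIn i (punchOut i≢j))                ≤⟨ +-monoʳ-≤ (f i) (≤-∑ (λ l → f (punchIn i l)) (punchOut i≢j)) ⟩
  f i + ∑[ l < n ] f (punchIn i l)                  ≡⟨ sym (sum-remove {i = i} f) ⟩
  ∑[ l < suc n ] f l                                ∎
  where open ≤-Reasoning

+-mono-≤-middle : ∀ {a b c e a′ b′ c′ e′} → a ≤ a′ → b + c ≤ b′ + c′ → e ≤ e′ →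
                  (a + b) + (c + e) ≤ (a′ + b′) + (c′ + e′)
+-mono-≤-middle {a} {b} {c} {e} {a′} {b′} {c′} {e′} a≤a′ bc≤b′c′ e≤e′ =
  subst₂ _≤_ (regroup a b c e) (regroup a′ b′ c′ e′) (+-mono-≤ (+-mono-≤ a≤a′ bc≤b′c′) e≤e′)
  where
  regroup : ∀ a b c e → a + (b + c) + e ≡ (a + b) + (c + e)
  regroup a b c e = trans (cong (_+ e) (sym (+-assoc a b c))) (+-assoc (a + b) c e)

∑-const-1 : ∀ n → ∑[ i < n ] 1 ≡ n
∑-const-1 zero    = refl
∑-const-1 (suc n) = cong suc (∑-const-1 n)

sum-map-tabulate : (g : Fin n → A) (f : A → ℕ) → sum (map f (List.tabulate g)) ≡ ∑[ i < n ] f (g i)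
sum-map-tabulate {zero}  g f = refl
sum-map-tabulate {suc n} g f = cong (f (g zero) +_) (sum-map-tabulate (g ∘ suc) f)

length-filter : {P : A → Set ℓ′} (P? : Decidable P) (xs : List A) →
                length (filter P? xs) ≡ sum (map (χ ∘ P?) xs)
length-filter P? List.[] = refl
length-filter P? (x List.∷ xs) with does (P? x)
... | true  = cong suc (length-filter P? xs)
... | false = length-filter P? xs

pointCases : (x y z : Fin n) (P : Fin n → Set ℓ) → P x → P y → (z ≢ x → z ≢ y → P z) → P z
pointCases x y z P px py pz with z ≟ x | z ≟ y
... | yes refl | _        = px
... | no _     | yes refl = py
... | no z≢x   | no z≢y   = pz z≢x z≢y

transpose-x : (x y : Fin n) → transpose x y ⟨$⟩ʳ x ≡ y
transpose-x x y rewrite dec-true (x ≟ x) refl = refl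

transpose-y : (x y : Fin n) → transpose x y ⟨$⟩ʳ y ≡ x
transpose-y x y with y ≟ x
... | yes refl = refl
... | no _ rewrite dec-true (y ≟ y) refl = refl

transpose-≢ : {x y z : Fin n} → z ≢ x → z ≢ y → transpose x y ⟨$⟩ʳ z ≡ z
transpose-≢ {x = x} {y} {z} z≢x z≢y rewrite dec-false (z ≟ x) z≢x | dec-false (z ≟ y) z≢y = refl

⟨$⟩ʳ-injective : (π : Permutation′ n) {a b : Fin n} → π ⟨$⟩ʳ a ≡ π ⟨$⟩ʳ b → a ≡ b
⟨$⟩ʳ-injective π eq = trans (sym (inverseˡ π)) (trans (cong (π ⟨$⟩ˡ_) eq) (inverseˡ π))

lookup⇒∉ : ∀ {p : Subset n} {x} → lookup p x ≡ false → x ∉ p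
lookup⇒∉ p[x]≡false x∈p with trans (sym p[x]≡false) ([]=⇒lookup x∈p)
... | ()

∣p∣≡∑χ : (p : Subset n) → ∣ p ∣ ≡ ∑[ z < n ] χ (z ∈? p)
∣p∣≡∑χ []          = refl
∣p∣≡∑χ (true ∷ p)  = cong suc (∣p∣≡∑χ p)
∣p∣≡∑χ (false ∷ p) = ∣p∣≡∑χ p

preimage : (Fin m → Fin n) → Subset n → Subset m
preimage f p = tabulate (lookup p ∘ f)

lookup-preimage : (f : Fin m → Fin n) (p : Subset n) (x : Fin m) → lookup (preimage f p) x ≡ lookup p (f x)
lookup-preimage f p = lookup∘tabulate (lookup p ∘ f)

∈-preimage⁺ : ∀ {f : Fin m → Fin n} {p x} → f x ∈ p → x ∈ preimage f p
∈-preimage⁺ {f = f} {p} {x} fx∈p = lookup⇒[]= _ _ (trans (lookup-preimage f p x) ([]=⇒lookup fx∈p))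

∈-preimage⁻ : ∀ {f : Fin m → Fin n} {p x} → x ∈ preimage f p → f x ∈ p
∈-preimage⁻ {f = f} {p} {x} x∈f⁻¹p = lookup⇒[]= _ _ (trans (sym (lookup-preimage f p x)) ([]=⇒lookup x∈f⁻¹p))

∣preimage∣ : (π : Permutation′ n) (p : Subset n) → ∣ preimage (π ⟨$⟩ʳ_) p ∣ ≡ ∣ p ∣
∣preimage∣ {n} π p = begin
  ∣ preimage (π ⟨$⟩ʳ_) p ∣                ≡⟨ ∣p∣≡∑χ (preimage (π ⟨$⟩ʳ_) p) ⟩
  ∑[ z < n ] χ (z ∈? preimage (π ⟨$⟩ʳ_) p)  ≡⟨ sum-cong-≗ (λ z → χ-cong (z ∈? _) (π ⟨$⟩ʳ z ∈? p) ∈-preimage⁻ ∈-preimage⁺) ⟩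
  ∑[ z < n ] χ (π ⟨$⟩ʳ z ∈? p)              ≡⟨ ∑-permute (λ z → χ (z ∈? p)) π ⟨
  ∑[ z < n ] χ (z ∈? p)                     ≡⟨ ∣p∣≡∑χ p ⟨
  ∣ p ∣                                     ∎
  where open ≡-Reasoning

exchange : Fin n → Fin n → Subset n → Subset n
exchange x y = preimage (transpose x y ⟨$⟩ʳ_)

∃-∈-∉ : ∀ {p q : Subset n} {x} → ∣ p ∣ ≡ ∣ q ∣ → x ∈ p → x ∉ q → ∃ λ y → y ∈ q × y ∉ p
∃-∈-∉ {p = p} {q} {x} ∣p∣≡∣q∣ x∈p x∉q with any? (λ y → (y ∈? q) ×-dec ¬? (y ∈? p))
... | yes found = found
... | no none = contradiction (p⊂q⇒∣p∣<∣q∣ (q⊆p , x , x∈p , x∉q)) (<-irrefl (sym ∣p∣≡∣q∣))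
  where
  q⊆p : q ⊆ p
  q⊆p {y} y∈q = decidable-stable (y ∈? p) (λ y∉p → none (y , y∈q , y∉p))

module _ {m k : ℕ} {A : Fin k → Subset m} (A-disjoint : PairwiseDisjoint A) where

  disjoint⇒≡ : ∀ {i j z} → z ∈ A i → z ∈ A j → i ≡ j
  disjoint⇒≡ {i} {j} {z} z∈Ai z∈Aj = decidable-stable (i ≟ j) (λ i≢j → A-disjoint i j i≢j z z∈Ai z∈Aj)

  PairwiseDisjoint-preimage : (f : Fin m → Fin m) → PairwiseDisjoint (preimage f ∘ A)
  PairwiseDisjoint-preimage f i j i≢j z z∈f⁻¹Ai z∈f⁻¹Aj =
    A-disjoint i j i≢j (f z) (∈-preimage⁻ z∈f⁻¹Ai) (∈-preimage⁻ z∈f⁻¹Aj)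

-- Sums over all subsets of [n]

sumSubsets : ∀ n → (Subset n → ℕ) → ℕ
sumSubsets zero    f = f []
sumSubsets (suc n) f = sumSubsets n (f ∘ (false ∷_)) + sumSubsets n (f ∘ (true ∷_))

sumSubsets-mono : {f g : Subset n → ℕ} → (∀ S → f S ≤ g S) → sumSubsets n f ≤ sumSubsets n g
sumSubsets-mono {zero}  f≤g = f≤g []
sumSubsets-mono {suc n} f≤g =
  +-mono-≤ (sumSubsets-mono (f≤g ∘ (false ∷_))) (sumSubsets-mono (f≤g ∘ (true ∷_)))

sumSubsets-+ : (f g : Subset n → ℕ) →
               sumSubsets n f + sumSubsets n g ≡ sumSubsets n (λ S → f S + g S)
sumSubsets-+ {zero}  f g = refl
sumSubsets-+ {suc n} f g = trans
  (interchange (sumSubsets n (f ∘ (false ∷_))) (sumSubsets n (f ∘ (true ∷_)))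
               (sumSubsets n (g ∘ (false ∷_))) (sumSubsets n (g ∘ (true ∷_))))
  (cong₂ _+_ (sumSubsets-+ (f ∘ (false ∷_)) (g ∘ (false ∷_)))
             (sumSubsets-+ (f ∘ (true ∷_)) (g ∘ (true ∷_))))

sumSubsets-suc : (f : Subset (suc n) → ℕ) →
                 sumSubsets (suc n) f ≡ sumSubsets n (λ T → f (false ∷ T) + f (true ∷ T))
sumSubsets-suc f = sumSubsets-+ (f ∘ (false ∷_)) (f ∘ (true ∷_))

sum-map-allSubsets : (f : Subset n → ℕ) → sum (map f (allSubsets n)) ≡ sumSubsets n f
sum-map-allSubsets {zero}  f = +-identityʳ (f [])
sum-map-allSubsets {suc n} f = begin
  sum (map f (map (false ∷_) Ss ++ map (true ∷_) Ss))
    ≡⟨ cong sum (map-++ f (map (false ∷_) Ss) _) ⟩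
  sum (map f (map (false ∷_) Ss) ++ map f (map (true ∷_) Ss))
    ≡⟨ sum-++ (map f (map (false ∷_) Ss)) _ ⟩
  sum (map f (map (false ∷_) Ss)) + sum (map f (map (true ∷_) Ss))
    ≡⟨ cong₂ _+_ (cong sum (map-∘ Ss)) (cong sum (map-∘ Ss)) ⟨
  sum (map (f ∘ (false ∷_)) Ss) + sum (map (f ∘ (true ∷_)) Ss)
    ≡⟨ cong₂ _+_ (sum-map-allSubsets (f ∘ (false ∷_))) (sum-map-allSubsets (f ∘ (true ∷_))) ⟩
  sumSubsets (suc n) f ∎
  where
  open ≡-Reasoning
  Ss : List (Subset n)
  Ss = allSubsets n

record IsPair (x : Fin n) (P : Bool → Subset n) : Set where
  field
    lookup-at  : ∀ b → lookup (P b) x ≡ b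
    lookup-off : ∀ b b′ {z} → z ≢ x → lookup (P b) z ≡ lookup (P b′) z

pair-head : (T : Subset n) → IsPair zero (_∷ T)
pair-head T = record { lookup-at = λ _ → refl ; lookup-off = off }
  where
  off : ∀ b b′ {z} → z ≢ zero → lookup (b ∷ T) z ≡ lookup (b′ ∷ T) z
  off _ _ {zero}  z≢0 = contradiction refl z≢0
  off _ _ {suc _} _   = refl

pair-tail : ∀ {x : Fin n} {P} (a : Bool) → IsPair x P → IsPair (suc x) (λ b → a ∷ P b)
pair-tail {P = P} a P-pair = record { lookup-at = lookup-at ; lookup-off = off }
  where
  open IsPair P-pair
  off : ∀ b b′ {z} → z ≢ suc _ → lookup (a ∷ P b) z ≡ lookup (a ∷ P b′) z
  off _ _  {zero}  _   = refl
  off b b′ {suc z} z≢x = lookup-off b b′ (z≢x ∘ cong suc)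

sumSubsets-pairwise : (x : Fin n) {f g : Subset n → ℕ} →
  (∀ P → IsPair x P → f (P false) + f (P true) ≤ g (P false) + g (P true)) →
  sumSubsets n f ≤ sumSubsets n g
sumSubsets-pairwise {suc n} zero {f} {g} h = begin
  sumSubsets (suc n) f                               ≡⟨ sumSubsets-suc f ⟩
  sumSubsets n (λ T → f (false ∷ T) + f (true ∷ T))  ≤⟨ sumSubsets-mono (λ T → h (_∷ T) (pair-head T)) ⟩
  sumSubsets n (λ T → g (false ∷ T) + g (true ∷ T))  ≡⟨ sumSubsets-suc g ⟨
  sumSubsets (suc n) g                               ∎
  where open ≤-Reasoning
sumSubsets-pairwise {suc n} (suc x) h =
  +-mono-≤ (sumSubsets-pairwise x (λ P P-pair → h _ (pair-tail false P-pair)))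
           (sumSubsets-pairwise x (λ P P-pair → h _ (pair-tail true P-pair)))

-- The four sets T, T ∪ {y}, T ∪ {x}, T ∪ {x, y} for some T avoiding x and y: B b c contains x
-- iff b and y iff c.
record IsBlock (x y : Fin n) (B : Bool → Bool → Subset n) : Set where
  field
    row    : ∀ b → IsPair y (B b)
    column : ∀ c → IsPair x (λ b → B b c)

  lookup-x : ∀ b c → lookup (B b c) x ≡ b
  lookup-x b c = IsPair.lookup-at (column c) b

  lookup-y : ∀ b c → lookup (B b c) y ≡ c
  lookup-y b c = IsPair.lookup-at (row b) c

  lookup-agree : ∀ b c b′ c′ {z} → z ≢ x → z ≢ y → lookup (B b c) z ≡ lookup (B b′ c′) z
  lookup-agree b c b′ c′ z≢x z≢y =
    trans (IsPair.lookup-off (column c) b b′ z≢x) (IsPair.lookup-off (row b′) c c′ z≢y)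

blockSum : (Subset n → ℕ) → (Bool → Bool → Subset n) → ℕ
blockSum f B = (f (B false false) + f (B false true)) + (f (B true false) + f (B true true))

blockSum-flip : (f : Subset n → ℕ) (B : Bool → Bool → Subset n) → blockSum f (flip B) ≡ blockSum f B
blockSum-flip f B = interchange (f (B false false)) (f (B true false)) (f (B false true)) (f (B true true))

block-flip : ∀ {x y : Fin n} {B} → IsBlock x y B → IsBlock y x (flip B)
block-flip B-block = record { row = column ; column = row }
  where open IsBlock B-block

block-tail : ∀ {x y : Fin n} {B} (a : Bool) → IsBlock x y B → IsBlock (suc x) (suc y) (λ b c → a ∷ B b c)
block-tail a B-block = record { row = λ b → pair-tail a (row b) ; column = λ c → pair-tail a (column c) }
  where open IsBlock B-block

block-head : ∀ {x : Fin n} {P} → IsPair x P → IsBlock (suc x) zero (λ b c → c ∷ P b)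
block-head P-pair = record { row = λ b → pair-head _ ; column = λ c → pair-tail c P-pair }

sumSubsets-blockwise : {x y : Fin n} → x ≢ y → {f g : Subset n → ℕ} →
  (∀ B → IsBlock x y B → blockSum f B ≤ blockSum g B) →
  sumSubsets n f ≤ sumSubsets n g
sumSubsets-blockwise {suc n} {zero}  {zero}  x≢y h = contradiction refl x≢y
sumSubsets-blockwise {suc n} {zero}  {suc y} _ {f} {g} h =
  subst₂ _≤_ (sym (sumSubsets-suc f)) (sym (sumSubsets-suc g)) (sumSubsets-pairwise y λ P P-pair →
    subst₂ _≤_ (blockSum-flip f (λ b c → c ∷ P b)) (blockSum-flip g (λ b c → c ∷ P b))
      (h _ (block-flip (block-head P-pair))))
sumSubsets-blockwise {suc n} {suc x} {zero}  _ {f} {g} h =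
  subst₂ _≤_ (sym (sumSubsets-suc f)) (sym (sumSubsets-suc g))
    (sumSubsets-pairwise x λ P P-pair → h _ (block-head P-pair))
sumSubsets-blockwise {suc n} {suc x} {suc y} x≢y h =
  +-mono-≤ (sumSubsets-blockwise (x≢y ∘ cong suc) (λ B B-block → h _ (block-tail false B-block)))
           (sumSubsets-blockwise (x≢y ∘ cong suc) (λ B B-block → h _ (block-tail true B-block)))

module _ {x y : Fin n} {B : Bool → Bool → Subset n} (B-block : IsBlock x y B) where
  open IsBlock B-block

  x∉block : ∀ c → x ∉ B false c
  x∉block c = lookup⇒∉ (lookup-x false c)

  y∈block : ∀ b → y ∈ B b true
  y∈block b = lookup⇒[]= _ _ (lookup-y b true)

  ∈-block-agree : ∀ {b c b′ c′ z} → z ≢ x → z ≢ y → z ∈ B b c → z ∈ B b′ c′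
  ∈-block-agree {b} {c} {b′} {c′} z≢x z≢y z∈B =
    lookup⇒[]= _ _ (trans (sym (lookup-agree b c b′ c′ z≢x z≢y)) ([]=⇒lookup z∈B))

  exchange-block : ∀ b c → exchange x y (B b c) ≡ B c b
  exchange-block b c = trans (tabulate-cong pointwise) (tabulate∘lookup (B c b))
    where
    pointwise : ∀ z → lookup (B b c) (transpose x y ⟨$⟩ʳ z) ≡ lookup (B c b) z
    pointwise z = pointCases x y z (λ z → lookup (B b c) (transpose x y ⟨$⟩ʳ z) ≡ lookup (B c b) z)
      (trans (cong (lookup (B b c)) (transpose-x x y)) (trans (lookup-y b c) (sym (lookup-x c b))))
      (trans (cong (lookup (B b c)) (transpose-y x y)) (trans (lookup-x b c) (sym (lookup-y c b))))
      (λ z≢x z≢y → trans (cong (lookup (B b c)) (transpose-≢ z≢x z≢y)) (lookup-agree b c c b z≢x z≢y))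

  ∣block∣ : ∀ b c → ∣ B b c ∣ ≡ ∣ B c b ∣
  ∣block∣ b c = trans (sym (∣preimage∣ (transpose x y) (B b c))) (cong ∣_∣ (exchange-block b c))

sumSubsets-exchange : {x y : Fin n} → x ≢ y → {f g : Subset n → ℕ} →
  (∀ S → f S ≤ g (exchange x y S)) → sumSubsets n f ≤ sumSubsets n g
sumSubsets-exchange {x = x} {y} x≢y {f} {g} f≤g = sumSubsets-blockwise x≢y λ B B-block →
  let f≤g′ : ∀ b c → f (B b c) ≤ g (B c b)
      f≤g′ b c = subst (λ S → f (B b c) ≤ g S) (exchange-block B-block b c) (f≤g (B b c))
  in ≤-trans (+-mono-≤ (+-mono-≤ (f≤g′ false false) (f≤g′ false true))
                      (+-mono-≤ (f≤g′ true false) (f≤g′ true true)))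
             (≤-reflexive (blockSum-flip g B))

-- Counting sets whose traces have a system of distinct representatives

module _ {m k : ℕ} {B B′ : Fin k → Subset m} where

  IsSDR-map : ∀ {v} (f : Fin m → Fin m) → (∀ {a b} → f a ≡ f b → a ≡ b) →
              (∀ i → f (lookup v i) ∈ B′ i) → IsSDR B v → HasSDR B′
  IsSDR-map {v} f f-injective f[v]∈B′ (_ , v-distinct) =
    Vec.map f v ,
    (λ i → subst (_∈ B′ i) (sym (lookup-map i f v)) (f[v]∈B′ i)) ,
    (λ i j eq → v-distinct i j (f-injective (trans (sym (lookup-map i f v)) (trans eq (lookup-map j f v)))))

  HasSDR-mono : (∀ i → B i ⊆ B′ i) → HasSDR B → HasSDR B′
  HasSDR-mono B⊆B′ (v , v∈B , v-distinct) = IsSDR-map {v} id id (λ i → B⊆B′ i (v∈B i)) (v∈B , v-distinct)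

  HasSDR-permute : (π : Permutation′ m) → (∀ i {z} → π ⟨$⟩ʳ z ∈ B i → z ∈ B′ i) → HasSDR B → HasSDR B′
  HasSDR-permute π π⁻¹B⊆B′ (v , v∈B , v-distinct) =
    IsSDR-map {v} (π ⟨$⟩ˡ_) (⟨$⟩ʳ-injective (Perm.flip π))
              (λ i → π⁻¹B⊆B′ i (subst (_∈ B i) (sym (inverseʳ π)) (v∈B i))) (v∈B , v-distinct)

module _ {m k : ℕ} (d : ℕ) where

  Good : (Fin k → Subset m) → Subset m → Set
  Good F S = ∣ S ∣ ≡ d × HasSDR (λ i → S ∩ F i)

  good? : (F : Fin k → Subset m) (S : Subset m) → Dec (Good F S)
  good? F S = (∣ S ∣ ℕ.≟ d) ×-dec HasSDR? (λ i → S ∩ F i)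

  sdrCount-sumSubsets : (F : Fin k → Subset m) → sdrCount m d F ≡ sumSubsets m (χ ∘ good? F)
  sdrCount-sumSubsets F = trans (length-filter (good? F) (allSubsets m)) (sum-map-allSubsets (χ ∘ good? F))

  sdrCount-≤ : {F G : Fin k → Subset m} → sumSubsets m (χ ∘ good? F) ≤ sumSubsets m (χ ∘ good? G) →
               sdrCount m d F ≤ sdrCount m d G
  sdrCount-≤ {F} {G} = subst₂ _≤_ (sym (sdrCount-sumSubsets F)) (sym (sdrCount-sumSubsets G))

  sdrCount-mono : {F G : Fin k → Subset m} → (∀ S → Good F S → Good G S) → sdrCount m d F ≤ sdrCount m d G
  sdrCount-mono {F} {G} F⇒G = sdrCount-≤ (sumSubsets-mono (λ S → χ-mono (good? F S) (good? G S) (F⇒G S)))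

  sdrCount-⊆ : {F G : Fin k → Subset m} → (∀ i → F i ⊆ G i) → sdrCount m d F ≤ sdrCount m d G
  sdrCount-⊆ {F} {G} F⊆G = sdrCount-mono λ S (∣S∣≡d , sdr) → ∣S∣≡d , HasSDR-mono (λ i z∈S∩Fi →
    let z∈S , z∈Fi = x∈p∩q⁻ S (F i) z∈S∩Fi in x∈p∩q⁺ (z∈S , F⊆G i z∈Fi)) sdr

  sdrCount-exchange : {F : Fin k → Subset m} {x y : Fin m} → x ≢ y →
                      sdrCount m d F ≤ sdrCount m d (exchange x y ∘ F)
  sdrCount-exchange {F} {x} {y} x≢y =
    sdrCount-≤ (sumSubsets-exchange x≢y λ S → χ-mono (good? F S) (good? (exchange x y ∘ F) (exchange x y S)) λ (∣S∣≡d , sdr) →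
        trans (∣preimage∣ (transpose x y) S) ∣S∣≡d ,
        HasSDR-permute (transpose x y) (λ i σz∈S∩Fi →
          let σz∈S , σz∈Fi = x∈p∩q⁻ S (F i) σz∈S∩Fi in x∈p∩q⁺ (∈-preimage⁺ σz∈S , ∈-preimage⁺ σz∈Fi)) sdr)

-- Moving a point of one member to an uncovered point

module Move {m k : ℕ} (F : Fin k → Subset m) (j : Fin k) {x y : Fin m}
            (x∈Fj : x ∈ F j) (y-free : ∀ l → y ∉ F l) where

  -- As y ∉ F j, exchanging x and y in F j alone moves x to y.
  F′ : Fin k → Subset m
  F′ = updateAt F j (exchange x y)

  x≢y : x ≢ y
  x≢y refl = y-free j x∈Fj

  F′-other : ∀ {l} → l ≢ j → F′ l ≡ F l
  F′-other {l} l≢j = updateAt-minimal l j F l≢j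

  y∈F′j : y ∈ F′ j
  y∈F′j = subst (y ∈_) (sym (updateAt-updates j F))
                (∈-preimage⁺ (subst (_∈ F j) (sym (transpose-y x y)) x∈Fj))

  ∈-F′ : ∀ {l z} → z ≢ x → z ∈ F l → z ∈ F′ l
  ∈-F′ {l} {z} z≢x z∈Fl with l ≟ j
  ... | yes refl = subst (z ∈_) (sym (updateAt-updates l F))
                         (∈-preimage⁺ (subst (_∈ F l) (sym (transpose-≢ z≢x z≢y)) z∈Fl))
    where
    z≢y : z ≢ y
    z≢y refl = y-free l z∈Fl
  ... | no l≢j = subst (z ∈_) (sym (F′-other l≢j)) z∈Fl

  ∣F′∣ : ∀ l → ∣ F′ l ∣ ≡ ∣ F l ∣
  ∣F′∣ l with l ≟ j
  ... | yes refl = trans (cong ∣_∣ (updateAt-updates l F)) (∣preimage∣ (transpose x y) (F l))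
  ... | no l≢j = cong ∣_∣ (F′-other l≢j)

  Agree : Subset m → Subset m → Set
  Agree S S′ = ∀ {z} → z ≢ x → z ≢ y → z ∈ S → z ∈ S′

  agree-refl : ∀ {S} → Agree S S
  agree-refl _ _ z∈S = z∈S

  keep : ∀ {S S′} v → IsSDR (λ i → S ∩ F i) v → lookup v j ≢ x →
         (∀ i → lookup v i ∈ S′) → HasSDR (λ i → S′ ∩ F′ i)
  keep {S} {S′} v (v∈S∩F , v-distinct) vj≢x v∈S′ =
    IsSDR-map {v = v} id id (λ i → x∈p∩q⁺ (v∈S′ i , v∈F′ i)) (v∈S∩F , v-distinct)
    where
    v∈F′ : ∀ i → lookup v i ∈ F′ i
    v∈F′ i with i ≟ j
    ... | yes refl = ∈-F′ vj≢x (proj₂ (x∈p∩q⁻ S (F i) (v∈S∩F i)))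
    ... | no i≢j = subst (lookup v i ∈_) (sym (F′-other i≢j)) (proj₂ (x∈p∩q⁻ S (F i) (v∈S∩F i)))

  relocate : ∀ {S S′} v → IsSDR (λ i → S ∩ F i) v → lookup v j ≡ x →
             y ∈ S′ → Agree S S′ → HasSDR (λ i → S′ ∩ F′ i)
  relocate {S} {S′} v (v∈S∩F , v-distinct) vj≡x y∈S′ S≈S′ =
    IsSDR-map {v = v} (σ ⟨$⟩ʳ_) (⟨$⟩ʳ-injective σ) σv∈S′∩F′ (v∈S∩F , v-distinct)
    where
    σ : Permutation′ m
    σ = transpose x y
    σv∈S′∩F′ : ∀ i → σ ⟨$⟩ʳ lookup v i ∈ S′ ∩ F′ i
    σv∈S′∩F′ i with i ≟ j
    ... | yes refl = subst (λ z → σ ⟨$⟩ʳ z ∈ S′ ∩ F′ i) (sym vj≡x)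
                           (subst (_∈ S′ ∩ F′ i) (sym (transpose-x x y)) (x∈p∩q⁺ (y∈S′ , y∈F′j)))
    ... | no i≢j = subst (_∈ S′ ∩ F′ i) (sym (transpose-≢ vi≢x vi≢y))
                         (x∈p∩q⁺ (S≈S′ vi≢x vi≢y vi∈S , subst (lookup v i ∈_) (sym (F′-other i≢j)) vi∈Fi))
      where
      vi∈S : lookup v i ∈ S
      vi∈S = proj₁ (x∈p∩q⁻ S (F i) (v∈S∩F i))
      vi∈Fi : lookup v i ∈ F i
      vi∈Fi = proj₂ (x∈p∩q⁻ S (F i) (v∈S∩F i))
      vi≢x : lookup v i ≢ x
      vi≢x eq = i≢j (v-distinct i j (trans eq (sym vj≡x)))
      vi≢y : lookup v i ≢ y
      vi≢y eq = y-free i (subst (_∈ F i) eq vi∈Fi)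

  keep-∉ : ∀ {S S′} → x ∉ S → Agree S S′ → HasSDR (λ i → S ∩ F i) → HasSDR (λ i → S′ ∩ F′ i)
  keep-∉ {S} x∉S S≈S′ (v , sdr@(v∈S∩F , _)) = keep v sdr (vi≢x j) λ i → S≈S′ (vi≢x i) (vi≢y i) (v∈S i)
    where
    v∈S : ∀ i → lookup v i ∈ S
    v∈S i = proj₁ (x∈p∩q⁻ S (F i) (v∈S∩F i))
    vi≢x : ∀ i → lookup v i ≢ x
    vi≢x i eq = x∉S (subst (_∈ S) eq (v∈S i))
    vi≢y : ∀ i → lookup v i ≢ y
    vi≢y i eq = y-free i (subst (_∈ F i) eq (proj₂ (x∈p∩q⁻ S (F i) (v∈S∩F i))))

  keep-or-relocate : ∀ {S S′} → y ∈ S′ → Agree S S′ → HasSDR (λ i → S ∩ F i) →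
                     HasSDR (λ i → S ∩ F′ i) ⊎ HasSDR (λ i → S′ ∩ F′ i)
  keep-or-relocate {S} y∈S′ S≈S′ (v , sdr@(v∈S∩F , _)) with lookup v j ≟ x
  ... | yes vj≡x = inj₂ (relocate v sdr vj≡x y∈S′ S≈S′)
  ... | no vj≢x = inj₁ (keep v sdr vj≢x (λ i → proj₁ (x∈p∩q⁻ S (F i) (v∈S∩F i))))

  module _ (d : ℕ) {B : Bool → Bool → Subset m} (B-block : IsBlock x y B) where

    neither : Good d F (B false false) → Good d F′ (B false false)
    neither = Product.map₂ (keep-∉ (x∉block B-block false) agree-refl)

    only-y : Good d F (B false true) → Good d F′ (B false true) × Good d F′ (B true false)
    only-y (∣S∣≡d , sdr) = (∣S∣≡d , keep-∉ (x∉block B-block true) agree-refl sdr) ,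
                           (trans (∣block∣ B-block true false) ∣S∣≡d ,
                            keep-∉ (x∉block B-block true) (∈-block-agree B-block) sdr)

    only-x : Good d F (B true false) → Good d F′ (B false true) ⊎ Good d F′ (B true false)
    only-x (∣S∣≡d , sdr) =
      [ (λ sdr′ → inj₂ (∣S∣≡d , sdr′)) , (λ sdr′ → inj₁ (trans (∣block∣ B-block false true) ∣S∣≡d , sdr′)) ]′
        (keep-or-relocate (y∈block B-block false) (∈-block-agree B-block) sdr)

    both : Good d F (B true true) → Good d F′ (B true true)
    both (∣S∣≡d , sdr) = ∣S∣≡d , [ id , id ]′ (keep-or-relocate (y∈block B-block true) agree-refl sdr)

  -- T ∪ {x} may lose its SDR for F′, but only to T ∪ {y}, which is then gained; whenever T ∪ {y}
  -- was already good for F, both sets are good for F′.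
  sdrCount-move : ∀ d → sdrCount m d F ≤ sdrCount m d F′
  sdrCount-move d = sdrCount-≤ d {F} {F′} (sumSubsets-blockwise x≢y λ B B-block →
    +-mono-≤-middle
         (χ-mono (good (B false false)) (good′ (B false false)) (neither d B-block))
         (χ-+-mono (good (B false true)) (good (B true false)) (good′ (B false true)) (good′ (B true false))
                   (only-y d B-block) (only-x d B-block))
         (χ-mono (good (B true true)) (good′ (B true true)) (both d B-block)))
    where
    good : (S : Subset m) → Dec (Good d F S)
    good = good? d F
    good′ : (S : Subset m) → Dec (Good d F′ S)
    good′ = good? d F′

module _ {m k : ℕ} where

  Uncovered : (Fin k → Subset m) → Fin m → Set
  Uncovered F z = ∀ l → z ∉ F l

  uncovered? : (F : Fin k → Subset m) (z : Fin m) → Dec (Uncovered F z)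
  uncovered? F z = all? (λ l → ¬? (z ∈? F l))

  #uncovered : (Fin k → Subset m) → ℕ
  #uncovered F = ∑[ z < m ] χ (uncovered? F z)

  ∑∣F∣≡∑coverage : (F : Fin k → Subset m) → ∑[ l < k ] ∣ F l ∣ ≡ ∑[ z < m ] ∑[ l < k ] χ (z ∈? F l)
  ∑∣F∣≡∑coverage F = trans (sum-cong-≗ (∣p∣≡∑χ ∘ F)) (∑-comm (λ l z → χ (z ∈? F l)))

  ∃-uncovered : (F : Fin k → Subset m) {i j : Fin k} {x : Fin m} → i ≢ j → x ∈ F i → x ∈ F j →
                ∑[ l < k ] ∣ F l ∣ ≤ m → ∃ (Uncovered F)
  ∃-uncovered F {i} {j} {x} i≢j x∈Fi x∈Fj ∑∣F∣≤m with any? (uncovered? F)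
  ... | yes found = found
  ... | no none = contradiction ∑∣F∣≤m (<⇒≱ m<∑∣F∣)
    where
    coverage : Fin m → ℕ
    coverage z = ∑[ l < k ] χ (z ∈? F l)
    covered : ∀ z → 1 ≤ coverage z
    covered z with any? (λ l → z ∈? F l)
    ... | yes (l , z∈Fl) = ≤-trans (χ-pos (z ∈? F l) z∈Fl) (≤-∑ (λ l → χ (z ∈? F l)) l)
    ... | no z-uncovered = contradiction (z , λ l z∈Fl → z-uncovered (l , z∈Fl)) none
    m<∑∣F∣ : m < ∑[ l < k ] ∣ F l ∣
    m<∑∣F∣ = begin-strict
      m                          ≡⟨ ∑-const-1 m ⟨
      ∑[ z < m ] 1               <⟨ ∑-mono-< x covered (≤-trans (+-mono-≤ (χ-pos (x ∈? F i) x∈Fi) (χ-pos (x ∈? F j) x∈Fj))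
                                                                (+-≤-∑ (λ l → χ (x ∈? F l)) i≢j)) ⟩
      ∑[ z < m ] coverage z      ≡⟨ ∑∣F∣≡∑coverage F ⟨
      ∑[ l < k ] ∣ F l ∣          ∎
      where open ≤-Reasoning

module _ {m k : ℕ} (F : Fin k → Subset m) {i j : Fin k} {x y : Fin m} (i≢j : i ≢ j)
         (x∈Fi : x ∈ F i) (x∈Fj : x ∈ F j) (y-free : ∀ l → y ∉ F l) where
  open Move F j x∈Fj y-free

  #uncovered-move : #uncovered F′ < #uncovered F
  #uncovered-move = ∑-mono-< y
    (λ z → χ-mono (uncovered? F′ z) (uncovered? F z) (still-uncovered z))
    (χ-mono-< (uncovered? F′ y) (uncovered? F y) (λ y-free′ → y-free′ j y∈F′j) y-free)
    where
    still-uncovered : ∀ z → Uncovered F′ z → Uncovered F z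
    still-uncovered z z-free′ l z∈Fl with z ≟ x
    ... | yes refl = z-free′ i (subst (z ∈_) (sym (F′-other i≢j)) x∈Fi)
    ... | no z≢x = z-free′ l (∈-F′ z≢x z∈Fl)

module _ {m k : ℕ} (d : ℕ) (a : Fin k → ℕ) (∑a≤m : ∑[ l < k ] a l ≤ m) where

  compress : (F : Fin k → Subset m) → (∀ l → ∣ F l ∣ ≡ a l) →
             ∃ λ F′ → PairwiseDisjoint F′ × (∀ l → ∣ F′ l ∣ ≡ a l) × sdrCount m d F ≤ sdrCount m d F′
  compress F ∣F∣≡a = go F ∣F∣≡a (<-wellFounded (#uncovered F))
    where
    go : (F : Fin k → Subset m) → (∀ l → ∣ F l ∣ ≡ a l) → Acc _<_ (#uncovered F) →
         ∃ λ F′ → PairwiseDisjoint F′ × (∀ l → ∣ F′ l ∣ ≡ a l) × sdrCount m d F ≤ sdrCount m d F′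
    go F ∣F∣≡a (acc smaller)
      with any? (λ i → any? λ j → ¬? (i ≟ j) ×-dec any? λ x → (x ∈? F i) ×-dec (x ∈? F j))
    ... | no no-overlap =
      F , (λ i j i≢j x x∈Fi x∈Fj → no-overlap (i , j , i≢j , x , x∈Fi , x∈Fj)) , ∣F∣≡a , ≤-refl
    ... | yes (i , j , i≢j , x , x∈Fi , x∈Fj) =
      let y , y-free = ∃-uncovered F i≢j x∈Fi x∈Fj (subst (_≤ m) (sym (sum-cong-≗ ∣F∣≡a)) ∑a≤m)
          open Move F j x∈Fj y-free
          F″ , F″-disjoint , ∣F″∣≡a , F′≤F″ =
            go F′ (λ l → trans (∣F′∣ l) (∣F∣≡a l)) (smaller (#uncovered-move F i≢j x∈Fi x∈Fj y-free))
      in F″ , F″-disjoint , ∣F″∣≡a , ≤-trans (sdrCount-move d) F′≤F″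

-- Disjoint families

module _ {m k : ℕ} {G : Fin k → Subset m} (G-disjoint : PairwiseDisjoint G) where

  Agreement : (Fin k → Subset m) → Fin k → Fin m → Set
  Agreement F l z = z ∈ F l × z ∈ G l

  #agreements : (Fin k → Subset m) → ℕ
  #agreements F = ∑[ l < k ] ∑[ z < m ] χ ((z ∈? F l) ×-dec (z ∈? G l))

  #agreements≤∑∣G∣ : (F : Fin k → Subset m) → #agreements F ≤ ∑[ l < k ] ∣ G l ∣
  #agreements≤∑∣G∣ F = ∑-mono-≤ λ l →
    ≤-trans (∑-mono-≤ (λ z → χ-mono ((z ∈? F l) ×-dec (z ∈? G l)) (z ∈? G l) proj₂))
            (≤-reflexive (sym (∣p∣≡∑χ (G l))))

  #agreements-exchange : ∀ {F : Fin k → Subset m} {j x y} → PairwiseDisjoint F →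
    x ∈ F j → x ∉ G j → y ∈ G j → y ∉ F j → #agreements F < #agreements (exchange x y ∘ F)
  #agreements-exchange {F} {j} {x} {y} F-disjoint x∈Fj x∉Gj y∈Gj y∉Fj =
    ∑-mono-< j (λ l → ∑-mono-≤ (λ z → χ-mono (agreement? F l z) (agreement? F′ l z) (preserved l z)))
      (∑-mono-< y (λ z → χ-mono (agreement? F j z) (agreement? F′ j z) (preserved j z))
        (χ-mono-< (agreement? F j y) (agreement? F′ j y) (y∉Fj ∘ proj₁) (y∈F′j , y∈Gj)))
    where
    F′ : Fin k → Subset m
    F′ = exchange x y ∘ F
    agreement? : ∀ F l z → Dec (Agreement F l z)
    agreement? F l z = (z ∈? F l) ×-dec (z ∈? G l)
    y∈F′j : y ∈ F′ j
    y∈F′j = ∈-preimage⁺ (subst (_∈ F j) (sym (transpose-y x y)) x∈Fj)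
    preserved : ∀ l z → Agreement F l z → Agreement F′ l z
    preserved l z = pointCases x y z (λ z → Agreement F l z → Agreement F′ l z)
      (λ (x∈Fl , x∈Gl) → contradiction (subst (λ l → x ∈ G l) (disjoint⇒≡ F-disjoint x∈Fl x∈Fj) x∈Gl) x∉Gj)
      (λ (y∈Fl , y∈Gl) → contradiction (subst (λ l → y ∈ F l) (disjoint⇒≡ G-disjoint y∈Gl y∈Gj) y∈Fl) y∉Fj)
      (λ z≢x z≢y (z∈Fl , z∈Gl) → ∈-preimage⁺ (subst (_∈ F l) (sym (transpose-≢ z≢x z≢y)) z∈Fl) , z∈Gl)

  disjoint-sdrCount-≤ : (d : ℕ) (F : Fin k → Subset m) → PairwiseDisjoint F → (∀ l → ∣ F l ∣ ≡ ∣ G l ∣) →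
                        sdrCount m d F ≤ sdrCount m d G
  disjoint-sdrCount-≤ d F F-disjoint ∣F∣≡∣G∣ =
    go F F-disjoint ∣F∣≡∣G∣ (<-wellFounded (∑[ l < k ] ∣ G l ∣ ∸ #agreements F))
    where
    go : (F : Fin k → Subset m) → PairwiseDisjoint F → (∀ l → ∣ F l ∣ ≡ ∣ G l ∣) →
         Acc _<_ (∑[ l < k ] ∣ G l ∣ ∸ #agreements F) → sdrCount m d F ≤ sdrCount m d G
    go F F-disjoint ∣F∣≡∣G∣ (acc smaller) with any? (λ l → any? λ z → (z ∈? F l) ×-dec ¬? (z ∈? G l))
    ... | no F⊆G = sdrCount-⊆ d λ l {z} z∈Fl → decidable-stable (z ∈? G l) (λ z∉Gl → F⊆G (l , z , z∈Fl , z∉Gl))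
    ... | yes (j , x , x∈Fj , x∉Gj) =
      let y , y∈Gj , y∉Fj = ∃-∈-∉ (∣F∣≡∣G∣ j) x∈Fj x∉Gj
          x≢y : x ≢ y
          x≢y x≡y = y∉Fj (subst (_∈ F j) x≡y x∈Fj)
      in ≤-trans (sdrCount-exchange d x≢y)
           (go (exchange x y ∘ F) (PairwiseDisjoint-preimage F-disjoint _)
               (λ l → trans (∣preimage∣ (transpose x y) (F l)) (∣F∣≡∣G∣ l))
               (smaller (∸-monoʳ-< (#agreements-exchange F-disjoint x∈Fj x∉Gj y∈Gj y∉Fj)
                                   (#agreements≤∑∣G∣ (exchange x y ∘ F)))))

lemma11 : (m k d : ℕ) → 1 ≤ m → 1 ≤ k → 1 ≤ d → k ≤ d →
          (a : Fin k → ℕ) → (∀ i → 1 ≤ a i) → sum (map a (allFin k)) ≤ m →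
          (F G : Fin k → Subset m) →
          (∀ i → ∣ F i ∣ ≡ a i) → (∀ i → ∣ G i ∣ ≡ a i) → PairwiseDisjoint G →
          sdrCount m d F ≤ sdrCount m d G
lemma11 m k d _ _ _ _ a _ ∑a≤m F G ∣F∣≡a ∣G∣≡a G-disjoint =
  let F′ , F′-disjoint , ∣F′∣≡a , F≤F′ = compress d a (subst (_≤ m) (sum-map-tabulate id a) ∑a≤m) F ∣F∣≡a
  in ≤-trans F≤F′ (disjoint-sdrCount-≤ G-disjoint d F′ F′-disjoint (λ l → trans (∣F′∣≡a l) (sym (∣G∣≡a l))))
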